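{- Let $K$ be a commutative ring with unity, $v,w:\mathbb Z\to K$, $\alpha,\beta\in\mathbb Z$, $s\in\mathbb N=\{0,1,2,\ldots\}$, and $r\ge 0$ an integer. With the $\mathcal V$-Stirling numbers as defined in the context, $$\det\Big(c^{\mathcal V}_{\alpha-i,\beta-j}[s+i+j,s+j]\Big)_{0\le i,j\le r}=\prod_{k=0}^{r}\ \prod_{t=1}^{k} v_{\alpha+s+k-t}\,w_{\beta-k+t-1},$$ i.e. the $k$-th factor is $v_{\alpha+s+k-1}w_{\beta-k}v_{\alpha+s+k-2}w_{\beta-k+1}\cdots v_{\alpha+s}w_{\beta-1}$ (equal to $1$ for $k=0$), and $$\det\Big(S^{\mathcal V}_{\alpha,\beta-j}[s+i+j,s+j]\Big)_{0\le i,j\le r}=\prod_{k=0}^{r}\left(v_{\alpha+s+k}w_{\beta-k}\right)^{k}.$$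
   Context: Let $K$ be a commutative ring with unity and $v,w:\mathbb Z\to K$ functions; write $v_i=v(i)$, $w_i=w(i)$ and $\mathcal V=(v,w)$. For finitely many variables, $e_t$ denotes the $t$-th elementary symmetric function and $h_t$ the $t$-th complete homogeneous symmetric function, with $e_0=h_0=1$ and $e_t=h_t=0$ for $t<0$ (and $e_t=0$ when $t$ exceeds the number of variables). For $\alpha,\beta\in\mathbb Z$ and integers $n,k\ge 0$ define $$c^{\mathcal V}_{\alpha,\beta}[n,k]=e_{n-k}\big(v_{\alpha+n-1}w_{\beta},v_{\alpha+n-2}w_{\beta+1},\ldots,v_{\alpha}w_{\beta+n-1}\big)$$ (the $n$ arguments $v_{\alpha+n-1-i}w_{\beta+i}$, $0\le i\le n-1$), and $$S^{\mathcal V}_{\alpha,\beta}[n,k]=h_{n-k}\big(v_{\alpha+k}w_{\beta},v_{\alpha+k-1}w_{\beta+1},\ldots,v_{\alpha}w_{\beta+k}\big)$$ (the $k+1$ arguments $v_{\alpha+k-i}w_{\beta+i}$, $0\le i\le k$). The matrices are indexed by row $i$ and column $j$; $x^0=1$. -}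

module Defs where

open import Level using (Level)
open import Algebra.Bundles using (CommutativeRing)
open import Data.Nat using (ℕ; zero; suc; _∸_; _≤ᵇ_)
open import Data.Bool using (if_then_else_)
open import Data.Fin using (Fin; zero; suc; punchIn; toℕ)
open import Data.Integer using (ℤ; +_; _-_)
import Data.Integer as ℤ
open import Data.List using (List; []; _∷_)

module VStirling {c ℓ : Level} (R : CommutativeRing c ℓ) where
  open CommutativeRing R using (Carrier; _+_; _*_; -_; 0#; 1#)

  pow : Carrier → ℕ → Carrier
  pow x zero = 1#
  pow x (suc m) = x * pow x m

  sumF : (n : ℕ) → (Fin n → Carrier) → Carrier
  sumF zero f = 0#
  sumF (suc n) f = f zero + sumF n (λ i → f (suc i))

  prodF : (n : ℕ) → (Fin n → Carrier) → Carrier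
  prodF zero f = 1#
  prodF (suc n) f = f zero * prodF n (λ i → f (suc i))

  elem : ℕ → List Carrier → Carrier
  elem zero xs = 1#
  elem (suc t) [] = 0#
  elem (suc t) (x ∷ xs) = elem (suc t) xs + x * elem t xs

  compl : ℕ → List Carrier → Carrier
  compl zero [] = 1#
  compl (suc t) [] = 0#
  compl t (x ∷ xs) = sumF (suc t) (λ m → pow x (toℕ m) * compl (t ∸ toℕ m) xs)

  elemℤ : ℤ → List Carrier → Carrier
  elemℤ (+ t) xs = elem t xs
  elemℤ ℤ.-[1+ _ ] xs = 0#

  complℤ : ℤ → List Carrier → Carrier
  complℤ (+ t) xs = compl t xs
  complℤ ℤ.-[1+ _ ] xs = 0#

  listOf : ℕ → (ℕ → Carrier) → List Carrier
  listOf zero f = []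
  listOf (suc n) f = f 0 ∷ listOf n (λ i → f (suc i))

  cV : (v w : ℤ → Carrier) → ℤ → ℤ → ℕ → ℕ → Carrier
  cV v w α β n k =
    elemℤ (+ n - + k) (listOf n (λ i → v (α ℤ.+ + n - ℤ.+ 1 - + i) * w (β ℤ.+ + i)))

  SV : (v w : ℤ → Carrier) → ℤ → ℤ → ℕ → ℕ → Carrier
  SV v w α β n k =
    complℤ (+ n - + k) (listOf (suc k) (λ i → v (α ℤ.+ + k - + i) * w (β ℤ.+ + i)))

  sign : ℕ → Carrier
  sign zero = 1#
  sign (suc i) = - (sign i)

  det : (n : ℕ) → (Fin n → Fin n → Carrier) → Carrier
  det zero M = 1#
  det (suc n) M =
    sumF (suc n) (λ j → sign (toℕ j) * (M zero j * det n (λ i k → M (suc i) (punchIn j k))))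

Eq : {c ℓ : Level} (R : CommutativeRing c ℓ) → CommutativeRing.Carrier R → CommutativeRing.Carrier R → Set ℓ
Eq R = CommutativeRing._≈_ R

Mul : {c ℓ : Level} (R : CommutativeRing c ℓ) → CommutativeRing.Carrier R → CommutativeRing.Carrier R → CommutativeRing.Carrier R
Mul R = CommutativeRing._*_ R

-- Put g(d) = v(α+s−1−d)·w(β+d) for the first kind and g(d) = v(α+s−d)·w(β+d)
-- for the second kind.  Entry (i,j) of either matrix is then e_i, resp. h_i,
-- of the list g(m−j), m = 0,1,…, so it depends on v, w, α, β only through g.
-- For such "normalized" matrices the first row consists of e_0 = h_0 = 1.
-- Replacing every column by its difference with the previous one leaves the
-- first row (1,0,…,0), and the Pascal recursions
--     e_{i+1}(x ∷ L) − e_{i+1}(L) = x·e_i(L),   h_{i+1}(x ∷ L) − h_{i+1}(L) = x·h_i(x ∷ L)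
-- show that column j of the remaining minor is g(−j−1) times column j of a
-- normalized matrix of the same kind with s+1 (and g shifted, for h).
-- Pulling these factors out gives an induction on the size r.
module Submission where

open import Defs
open import Level using (Level; _⊔_)
open import Algebra.Bundles using (CommutativeRing)
open import Data.Nat using (ℕ; zero; suc; pred; _<_; _≤_; z≤n; s≤s; _≤?_; _≟_)
import Data.Nat as ℕ
open import Data.Nat.Properties
  using (≤-trans; <⇒≤; <⇒≱; ≰⇒>; ≤-pred; +-suc; m≤m+n; suc-injective; <-cmp; ≤-refl; 1+n≢n)
open import Data.Fin using (Fin; toℕ; punchIn)
import Data.Fin as F
open import Data.Integer using (ℤ; +_)
import Data.Integer as ℤ
open import Data.Integer.Tactic.RingSolver using (solve-∀)
open import Data.Integer.Properties using (pos-+; [1+m]⊖[1+n]≡m⊖n; m-n≡m⊖n)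
open import Data.List using (List; []; _∷_)
open import Data.Sum using (_⊎_; inj₁; inj₂)
open import Data.Product using (Σ-syntax; _×_; _,_)
open import Data.Empty using (⊥-elim)
open import Relation.Nullary using (¬_; yes; no)
open import Relation.Binary.Definitions using (tri<; tri≈; tri>)
open import Relation.Binary.PropositionalEquality using (_≡_; _≢_)
import Relation.Binary.PropositionalEquality as P
import Algebra.Properties.Ring as RingProperties
import Algebra.Properties.AbelianGroup as AbelianGroupProperties
import Algebra.Properties.CommutativeSemigroup as CommutativeSemigroupProperties

-- Punch-in on ℕ: `punchInℕ j k` is the k-th natural number different from j,
-- i.e. the column of a matrix that column k of its j-th first-row minor comes from.
punchInℕ : ℕ → ℕ → ℕ
punchInℕ zero    k       = suc k
punchInℕ (suc j) zero    = zero
punchInℕ (suc j) (suc k) = suc (punchInℕ j k)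

punchOutℕ : ℕ → ℕ → ℕ
punchOutℕ zero    zero    = zero
punchOutℕ zero    (suc c) = c
punchOutℕ (suc j) zero    = zero
punchOutℕ (suc j) (suc c) = suc (punchOutℕ j c)

toℕ-punchIn : ∀ {n} (j : Fin (suc n)) (k : Fin n) → toℕ (punchIn j k) ≡ punchInℕ (toℕ j) (toℕ k)
toℕ-punchIn F.zero    k         = P.refl
toℕ-punchIn (F.suc j) F.zero    = P.refl
toℕ-punchIn (F.suc j) (F.suc k) = P.cong suc (toℕ-punchIn j k)

punchInℕ-≤ : ∀ j k → punchInℕ j k ≤ suc k
punchInℕ-≤ zero    k       = ≤-refl
punchInℕ-≤ (suc j) zero    = z≤n
punchInℕ-≤ (suc j) (suc k) = s≤s (punchInℕ-≤ j k)

punchInℕ-< : ∀ {n} j k → k < n → punchInℕ j k < suc n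
punchInℕ-< j k k<n = s≤s (≤-trans (punchInℕ-≤ j k) k<n)

punchInℕ-≢ : ∀ j k → punchInℕ j k ≢ j
punchInℕ-≢ zero    k       ()
punchInℕ-≢ (suc j) zero    ()
punchInℕ-≢ (suc j) (suc k) eq = punchInℕ-≢ j k (suc-injective eq)

punchInℕ-injective : ∀ j k k′ → punchInℕ j k ≡ punchInℕ j k′ → k ≡ k′
punchInℕ-injective zero    k       k′       eq = suc-injective eq
punchInℕ-injective (suc j) zero    zero     eq = P.refl
punchInℕ-injective (suc j) (suc k) (suc k′) eq =
  P.cong suc (punchInℕ-injective j k k′ (suc-injective eq))

punchInℕ-punchOutℕ : ∀ j c → c ≢ j → punchInℕ j (punchOutℕ j c) ≡ c
punchInℕ-punchOutℕ zero    zero    c≢j = ⊥-elim (c≢j P.refl)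
punchInℕ-punchOutℕ zero    (suc c) c≢j = P.refl
punchInℕ-punchOutℕ (suc j) zero    c≢j = P.refl
punchInℕ-punchOutℕ (suc j) (suc c) c≢j = P.cong suc (punchInℕ-punchOutℕ j c (λ e → c≢j (P.cong suc e)))

punchOutℕ-< : ∀ {n} j c → c ≢ j → j < suc n → c < suc n → punchOutℕ j c < n
punchOutℕ-< zero    zero    c≢j _ _ = ⊥-elim (c≢j P.refl)
punchOutℕ-< zero    (suc c) c≢j _ (s≤s c<n) = c<n
punchOutℕ-< {zero}  (suc j) c c≢j (s≤s ()) _
punchOutℕ-< {suc n} (suc j) zero    c≢j _ _ = s≤s z≤n
punchOutℕ-< {suc n} (suc j) (suc c) c≢j (s≤s j<) (s≤s c<) =
  s≤s (punchOutℕ-< j c (λ e → c≢j (P.cong suc e)) j< c<)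

punchInℕ-below : ∀ j k → k < j → punchInℕ j k ≡ k
punchInℕ-below (suc j) zero    _         = P.refl
punchInℕ-below (suc j) (suc k) (s≤s k<j) = P.cong suc (punchInℕ-below j k k<j)

punchInℕ-above : ∀ j k → j ≤ k → punchInℕ j k ≡ suc k
punchInℕ-above zero    k       _         = P.refl
punchInℕ-above (suc j) (suc k) (s≤s j≤k) = P.cong suc (punchInℕ-above j k j≤k)

punchInℕ-adjacent : ∀ a k → punchInℕ a k ≡ punchInℕ (suc a) k
                              ⊎ (punchInℕ a k ≡ suc a × punchInℕ (suc a) k ≡ a)
punchInℕ-adjacent zero    zero    = inj₂ (P.refl , P.refl)
punchInℕ-adjacent zero    (suc k) = inj₁ P.refl
punchInℕ-adjacent (suc a) zero    = inj₁ P.refl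
punchInℕ-adjacent (suc a) (suc k) with punchInℕ-adjacent a k
... | inj₁ e          = inj₁ (P.cong suc e)
... | inj₂ (e₁ , e₂)  = inj₂ (P.cong suc e₁ , P.cong suc e₂)

module RangeSums {c ℓ : Level} (R : CommutativeRing c ℓ) where
  open CommutativeRing R
  open VStirling R using (sumF; prodF)
  open import Relation.Binary.Reasoning.Setoid setoid
  open CommutativeSemigroupProperties *-commutativeSemigroup using ()
    renaming (interchange to *-interchange)
  open CommutativeSemigroupProperties +-commutativeSemigroup using ()
    renaming (interchange to +-interchange)

  sumN : ℕ → (ℕ → Carrier) → Carrier
  sumN zero    f = 0#
  sumN (suc n) f = f 0 + sumN n (λ j → f (suc j))

  prodN : ℕ → (ℕ → Carrier) → Carrier
  prodN zero    f = 1#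
  prodN (suc n) f = f 0 * prodN n (λ j → f (suc j))

  sumN-cong : ∀ n {f g : ℕ → Carrier} → (∀ j → j < n → f j ≈ g j) → sumN n f ≈ sumN n g
  sumN-cong zero    f≈g = refl
  sumN-cong (suc n) f≈g = +-cong (f≈g 0 (s≤s z≤n)) (sumN-cong n (λ j j< → f≈g (suc j) (s≤s j<)))

  prodN-cong : ∀ n {f g : ℕ → Carrier} → (∀ j → j < n → f j ≈ g j) → prodN n f ≈ prodN n g
  prodN-cong zero    f≈g = refl
  prodN-cong (suc n) f≈g = *-cong (f≈g 0 (s≤s z≤n)) (prodN-cong n (λ j j< → f≈g (suc j) (s≤s j<)))

  sumN-zero : ∀ n {f : ℕ → Carrier} → (∀ j → j < n → f j ≈ 0#) → sumN n f ≈ 0#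
  sumN-zero zero    f≈0 = refl
  sumN-zero (suc n) f≈0 =
    trans (+-cong (f≈0 0 (s≤s z≤n)) (sumN-zero n (λ j j< → f≈0 (suc j) (s≤s j<)))) (+-identityʳ 0#)

  sumN-pair : ∀ n a (f : ℕ → Carrier) → suc a < n →
    (∀ j → j < n → j ≢ a → j ≢ suc a → f j ≈ 0#) → f a + f (suc a) ≈ 0# → sumN n f ≈ 0#
  sumN-pair (suc (suc n)) zero f _ rest≈0 pair≈0 = begin
    f 0 + (f 1 + sumN n (λ j → f (suc (suc j)))) ≈⟨ sym (+-assoc _ _ _) ⟩
    (f 0 + f 1) + sumN n (λ j → f (suc (suc j)))
      ≈⟨ +-cong pair≈0 (sumN-zero n (λ j j< → rest≈0 (suc (suc j)) (s≤s (s≤s j<)) (λ ()) (λ ()))) ⟩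
    0# + 0#                                      ≈⟨ +-identityʳ 0# ⟩
    0#                                           ∎
  sumN-pair (suc n) (suc a) f (s≤s a<n) rest≈0 pair≈0 =
    trans (+-cong (rest≈0 0 (s≤s z≤n) (λ ()) (λ ()))
                  (sumN-pair n a (λ j → f (suc j)) a<n
                    (λ j j< ≢a ≢sa → rest≈0 (suc j) (s≤s j<)
                                       (λ e → ≢a (suc-injective e)) (λ e → ≢sa (suc-injective e)))
                    pair≈0))
          (+-identityˡ 0#)

  sumN-linear : ∀ n a b (f g : ℕ → Carrier) → sumN n (λ j → a * f j + b * g j) ≈ a * sumN n f + b * sumN n g
  sumN-linear zero    a b f g = sym (trans (+-cong (zeroʳ a) (zeroʳ b)) (+-identityʳ 0#))
  sumN-linear (suc n) a b f g =
    trans (+-cong refl (sumN-linear n a b (λ j → f (suc j)) (λ j → g (suc j))))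
          (trans (+-interchange _ _ _ _) (+-cong (sym (distribˡ a _ _)) (sym (distribˡ b _ _))))

  sumN-scale : ∀ n x (f : ℕ → Carrier) → sumN n (λ j → x * f j) ≈ x * sumN n f
  sumN-scale zero    x f = sym (zeroʳ x)
  sumN-scale (suc n) x f = trans (+-cong refl (sumN-scale n x (λ j → f (suc j)))) (sym (distribˡ x _ _))

  prodN-mul : ∀ n (f g : ℕ → Carrier) → prodN n (λ k → f k * g k) ≈ prodN n f * prodN n g
  prodN-mul zero    f g = sym (*-identityˡ 1#)
  prodN-mul (suc n) f g =
    trans (*-cong refl (prodN-mul n (λ k → f (suc k)) (λ k → g (suc k)))) (*-interchange _ _ _ _)

  prodN-punchIn : ∀ n (f : ℕ → Carrier) j → j < suc n →
    f j * prodN n (λ k → f (punchInℕ j k)) ≈ prodN (suc n) f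
  prodN-punchIn n       f zero    _ = refl
  prodN-punchIn (suc n) f (suc j) (s≤s j<) =
    trans (x∙yz≈y∙xz _ _ _) (*-cong refl (prodN-punchIn n (λ k → f (suc k)) j j<))
    where open CommutativeSemigroupProperties *-commutativeSemigroup using (x∙yz≈y∙xz)

  sumF-cong : ∀ n {f g : Fin n → Carrier} → (∀ j → f j ≈ g j) → sumF n f ≈ sumF n g
  sumF-cong zero    f≈g = refl
  sumF-cong (suc n) f≈g = +-cong (f≈g F.zero) (sumF-cong n (λ j → f≈g (F.suc j)))

  sumF-scale : ∀ n x (f : Fin n → Carrier) → sumF n (λ j → x * f j) ≈ x * sumF n f
  sumF-scale zero    x f = sym (zeroʳ x)
  sumF-scale (suc n) x f = trans (+-cong refl (sumF-scale n x (λ j → f (F.suc j)))) (sym (distribˡ x _ _))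

  sumF≈sumN : ∀ n (f : ℕ → Carrier) → sumF n (λ j → f (toℕ j)) ≈ sumN n f
  sumF≈sumN zero    f = refl
  sumF≈sumN (suc n) f = +-cong refl (sumF≈sumN n (λ j → f (suc j)))

  prodF≈prodN : ∀ n (f : ℕ → Carrier) → prodF n (λ j → f (toℕ j)) ≈ prodN n f
  prodF≈prodN zero    f = refl
  prodF≈prodN (suc n) f = *-cong refl (prodF≈prodN n (λ j → f (suc j)))

module Determinants {c ℓ : Level} (R : CommutativeRing c ℓ) where
  open CommutativeRing R
  open VStirling R using (sign; det)
  open RangeSums R
  open import Relation.Binary.Reasoning.Setoid setoid
  open RingProperties ring using (-1*x≈-x; -‿distribˡ-*)
  open CommutativeSemigroupProperties *-commutativeSemigroup using (x∙yz≈y∙xz; interchange)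

  Matrix : Set c
  Matrix = ℕ → ℕ → Carrier

  minor : Matrix → ℕ → Matrix
  minor M j i k = M (suc i) (punchInℕ j k)

  detN : ℕ → Matrix → Carrier
  cofactorTerm : ℕ → Matrix → ℕ → Carrier

  detN zero    M = 1#
  detN (suc n) M = sumN (suc n) (cofactorTerm n M)

  cofactorTerm n M j = sign j * (M 0 j * detN n (minor M j))

  det-cong : ∀ n {M N : Fin n → Fin n → Carrier} → (∀ i j → M i j ≈ N i j) → det n M ≈ det n N
  det-cong zero    M≈N = refl
  det-cong (suc n) M≈N = sumF-cong (suc n) (λ j → *-cong (refl {sign (toℕ j)}) (*-cong (M≈N F.zero j)
    (det-cong n (λ i k → M≈N (F.suc i) (punchIn j k)))))

  det≈detN : ∀ n (M : Matrix) → det n (λ i j → M (toℕ i) (toℕ j)) ≈ detN n M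
  det≈detN zero    M = refl
  det≈detN (suc n) M = trans
    (sumF-cong (suc n) (λ j → *-cong (refl {sign (toℕ j)}) (*-cong (refl {M 0 (toℕ j)})
      (trans (det-cong n (λ i k → reflexive (P.cong (M (suc (toℕ i))) (toℕ-punchIn j k))))
             (det≈detN n (minor M (toℕ j)))))))
    (sumF≈sumN (suc n) (cofactorTerm n M))

  detN-cong : ∀ n {M N : Matrix} → (∀ i j → i < n → j < n → M i j ≈ N i j) → detN n M ≈ detN n N
  detN-cong zero    M≈N = refl
  detN-cong (suc n) M≈N = sumN-cong (suc n) (λ j j< → *-cong (refl {sign j}) (*-cong (M≈N 0 j (s≤s z≤n) j<)
    (detN-cong n (λ i k i< k< → M≈N (suc i) (punchInℕ j k) (s≤s i<) (punchInℕ-< j k k<)))))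

  record ColumnCombination (col : ℕ) (a b : Carrier) (M₁ M₂ M₃ : Matrix) : Set (c ⊔ ℓ) where
    field
      outside₂ : ∀ i j → j ≢ col → M₂ i j ≈ M₁ i j
      outside₃ : ∀ i j → j ≢ col → M₃ i j ≈ M₁ i j
      column   : ∀ i → M₃ i col ≈ a * M₁ i col + b * M₂ i col

  combination-minor : ∀ {col a b M₁ M₂ M₃} j → col ≢ j → ColumnCombination col a b M₁ M₂ M₃ →
    ColumnCombination (punchOutℕ j col) a b (minor M₁ j) (minor M₂ j) (minor M₃ j)
  combination-minor {col} {a} {b} {M₁} {M₂} {M₃} j col≢j comb = record
    { outside₂ = λ i k k≢ → outside₂ (suc i) (punchInℕ j k) (avoids k k≢)
    ; outside₃ = λ i k k≢ → outside₃ (suc i) (punchInℕ j k) (avoids k k≢)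
    ; column   = λ i → P.subst (λ z → M₃ (suc i) z ≈ a * M₁ (suc i) z + b * M₂ (suc i) z)
                                (P.sym back) (column (suc i))
    }
    where
    open ColumnCombination comb
    back : punchInℕ j (punchOutℕ j col) ≡ col
    back = punchInℕ-punchOutℕ j col col≢j
    avoids : ∀ k → k ≢ punchOutℕ j col → punchInℕ j k ≢ col
    avoids k k≢ e = k≢ (punchInℕ-injective j k _ (P.trans e (P.sym back)))

  detN-linear : ∀ n {col a b M₁ M₂ M₃} → col < n → ColumnCombination col a b M₁ M₂ M₃ →
    detN n M₃ ≈ a * detN n M₁ + b * detN n M₂
  detN-linear (suc n) {col} {a} {b} {M₁} {M₂} {M₃} col< comb =
    trans (sumN-cong (suc n) term) (sumN-linear (suc n) a b (cofactorTerm n M₁) (cofactorTerm n M₂))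
    where
    open ColumnCombination comb
    term : ∀ j → j < suc n → cofactorTerm n M₃ j ≈ a * cofactorTerm n M₁ j + b * cofactorTerm n M₂ j
    term j j< with j ≟ col
    ... | yes P.refl = begin
      sign j * (M₃ 0 j * detN n (minor M₃ j))
        ≈⟨ *-cong refl (*-cong (column 0)
             (detN-cong n (λ i k _ _ → outside₃ (suc i) (punchInℕ j k) (punchInℕ-≢ j k)))) ⟩
      sign j * ((a * M₁ 0 j + b * M₂ 0 j) * detN n (minor M₁ j))
        ≈⟨ *-cong refl (distribʳ _ _ _) ⟩
      sign j * (a * M₁ 0 j * detN n (minor M₁ j) + b * M₂ 0 j * detN n (minor M₁ j))
        ≈⟨ distribˡ _ _ _ ⟩
      sign j * (a * M₁ 0 j * detN n (minor M₁ j)) + sign j * (b * M₂ 0 j * detN n (minor M₁ j))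
        ≈⟨ +-cong (pull a) (trans (pull b) (*-cong refl (*-cong refl (*-cong refl
             (detN-cong n (λ i k _ _ → sym (outside₂ (suc i) (punchInℕ j k) (punchInℕ-≢ j k)))))))) ⟩
      a * cofactorTerm n M₁ j + b * cofactorTerm n M₂ j ∎
      where
      pull : ∀ {x y} z → sign j * (z * x * y) ≈ z * (sign j * (x * y))
      pull z = trans (*-cong refl (*-assoc _ _ _)) (x∙yz≈y∙xz _ _ _)
    ... | no j≢col = begin
      sign j * (M₃ 0 j * detN n (minor M₃ j))
        ≈⟨ *-cong refl (*-cong (outside₃ 0 j j≢col) minor-linear) ⟩
      sign j * (M₁ 0 j * (a * detN n (minor M₁ j) + b * detN n (minor M₂ j)))
        ≈⟨ *-cong refl (distribˡ _ _ _) ⟩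
      sign j * (M₁ 0 j * (a * detN n (minor M₁ j)) + M₁ 0 j * (b * detN n (minor M₂ j)))
        ≈⟨ distribˡ _ _ _ ⟩
      sign j * (M₁ 0 j * (a * detN n (minor M₁ j))) + sign j * (M₁ 0 j * (b * detN n (minor M₂ j)))
        ≈⟨ +-cong (pull a) (trans (pull b) (*-cong refl (*-cong refl (*-cong (sym (outside₂ 0 j j≢col)) refl)))) ⟩
      a * cofactorTerm n M₁ j + b * cofactorTerm n M₂ j ∎
      where
      col≢j : col ≢ j
      col≢j e = j≢col (P.sym e)
      minor-linear : detN n (minor M₃ j) ≈ a * detN n (minor M₁ j) + b * detN n (minor M₂ j)
      minor-linear = detN-linear n (punchOutℕ-< j col col≢j j< col<) (combination-minor j col≢j comb)
      pull : ∀ {x y} z → sign j * (x * (z * y)) ≈ z * (sign j * (x * y))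
      pull z = trans (*-cong refl (x∙yz≈y∙xz _ _ _)) (x∙yz≈y∙xz _ _ _)

  AdjacentEqual : Matrix → ℕ → Set ℓ
  AdjacentEqual M a = ∀ i → M i a ≈ M i (suc a)

  minor-adjacentEqual : ∀ n M a j → j < suc n → suc a < suc n → j ≢ a → j ≢ suc a → AdjacentEqual M a →
    Σ[ a′ ∈ ℕ ] suc a′ < n × AdjacentEqual (minor M j) a′
  minor-adjacentEqual n M a j j< a< j≢a j≢sa eq with <-cmp j a
  ... | tri≈ _ j≡a _ = ⊥-elim (j≢a j≡a)
  minor-adjacentEqual n M (suc a′) j j< (s≤s a<) j≢a j≢sa eq | tri< (s≤s j≤a′) _ _ =
    a′ , a< , λ i → P.subst₂ (λ u v → M (suc i) u ≈ M (suc i) v)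
                      (P.sym (punchInℕ-above j a′ j≤a′))
                      (P.sym (punchInℕ-above j (suc a′) (<⇒≤ (s≤s j≤a′)))) (eq (suc i))
  minor-adjacentEqual n M a j j< a< j≢a j≢sa eq | tri> _ _ a<j =
    a , ≤-trans sa<j (≤-pred j<) , λ i → P.subst₂ (λ u v → M (suc i) u ≈ M (suc i) v)
                      (P.sym (punchInℕ-below j a a<j)) (P.sym (punchInℕ-below j (suc a) sa<j)) (eq (suc i))
    where
    sa<j : suc a < j
    sa<j with <-cmp (suc a) j
    ... | tri< sa<j _ _ = sa<j
    ... | tri≈ _ e _    = ⊥-elim (j≢sa (P.sym e))
    ... | tri> _ _ j<sa = ⊥-elim (<⇒≱ a<j (≤-pred j<sa))

  minor-adjacent : ∀ M a → AdjacentEqual M a → ∀ i k → minor M a i k ≈ minor M (suc a) i k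
  minor-adjacent M a eq i k with punchInℕ-adjacent a k
  ... | inj₁ e          = reflexive (P.cong (M (suc i)) e)
  ... | inj₂ (e₁ , e₂)  =
    P.subst₂ (λ u v → M (suc i) u ≈ M (suc i) v) (P.sym e₁) (P.sym e₂) (sym (eq (suc i)))

  -- Two equal adjacent columns force the determinant to vanish: the cofactor terms
  -- at a and a+1 cancel, all others have minors with equal adjacent columns.
  detN-alternating : ∀ n M a → suc a < n → AdjacentEqual M a → detN n M ≈ 0#
  detN-alternating (suc n) M a a< eq = sumN-pair (suc n) a (cofactorTerm n M) a< others cancel
    where
    others : ∀ j → j < suc n → j ≢ a → j ≢ suc a → cofactorTerm n M j ≈ 0#
    others j j< j≢a j≢sa with minor-adjacentEqual n M a j j< a< j≢a j≢sa eq
    ... | a′ , a′< , eq′ = trans (*-cong refl (*-cong refl (detN-alternating n (minor M j) a′ a′< eq′)))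
                                 (trans (*-cong refl (zeroʳ _)) (zeroʳ _))
    cancel : cofactorTerm n M a + cofactorTerm n M (suc a) ≈ 0#
    cancel = begin
      sign a * (M 0 a * detN n (minor M a)) + - sign a * (M 0 (suc a) * detN n (minor M (suc a)))
        ≈⟨ +-cong refl (*-cong refl (*-cong (sym (eq 0))
             (detN-cong n (λ i k _ _ → sym (minor-adjacent M a eq i k))))) ⟩
      sign a * (M 0 a * detN n (minor M a)) + - sign a * (M 0 a * detN n (minor M a))
        ≈⟨ +-cong refl (sym (-‿distribˡ-* _ _)) ⟩
      sign a * (M 0 a * detN n (minor M a)) - sign a * (M 0 a * detN n (minor M a))
        ≈⟨ -‿inverseʳ _ ⟩
      0# ∎

  copyColumn : Matrix → ℕ → Matrix
  copyColumn M a i j with j ≟ suc a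
  ... | yes _ = M i a
  ... | no  _ = M i j

  copyColumn-target : ∀ M a i → copyColumn M a i (suc a) ≈ M i a
  copyColumn-target M a i with suc a ≟ suc a
  ... | yes _ = refl
  ... | no ne = ⊥-elim (ne P.refl)

  copyColumn-other : ∀ M a i j → j ≢ suc a → copyColumn M a i j ≈ M i j
  copyColumn-other M a i j ne with j ≟ suc a
  ... | yes e = ⊥-elim (ne e)
  ... | no  _ = refl

  -- Subtracting column a from column a+1 does not change the determinant:
  -- by linearity it adds −1 times a determinant with two equal columns.
  detN-subtractColumn : ∀ n (M M′ : Matrix) a → suc a < n →
    (∀ i j → j ≢ suc a → M′ i j ≈ M i j) → (∀ i → M′ i (suc a) ≈ M i (suc a) - M i a) →
    detN n M′ ≈ detN n M
  detN-subtractColumn n M M′ a a< outside target = begin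
    detN n M′                                      ≈⟨ detN-linear n a< combination ⟩
    1# * detN n M + - 1# * detN n (copyColumn M a)
      ≈⟨ +-cong (*-identityˡ _) (*-cong refl (detN-alternating n (copyColumn M a) a a< equal)) ⟩
    detN n M + - 1# * 0#                           ≈⟨ +-cong refl (zeroʳ _) ⟩
    detN n M + 0#                                  ≈⟨ +-identityʳ _ ⟩
    detN n M                                       ∎
    where
    combination : ColumnCombination (suc a) 1# (- 1#) M (copyColumn M a) M′
    combination = record
      { outside₂ = copyColumn-other M a
      ; outside₃ = outside
      ; column   = λ i → trans (target i) (+-cong (sym (*-identityˡ _))
                           (trans (sym (-1*x≈-x _)) (*-cong refl (sym (copyColumn-target M a i)))))
      }
    equal : AdjacentEqual (copyColumn M a) a
    equal i = trans (copyColumn-other M a i a (λ e → 1+n≢n (P.sym e))) (sym (copyColumn-target M a i))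

  differencesFrom : ℕ → Matrix → Matrix
  differencesFrom k M i j with k ≤? j
  ... | yes _ = M i j - M i (pred j)
  ... | no  _ = M i j

  differencesFrom-≤ : ∀ k M i j → k ≤ j → differencesFrom k M i j ≈ M i j - M i (pred j)
  differencesFrom-≤ k M i j k≤j with k ≤? j
  ... | yes _   = refl
  ... | no  k≰j = ⊥-elim (k≰j k≤j)

  differencesFrom-≰ : ∀ k M i j → ¬ k ≤ j → differencesFrom k M i j ≈ M i j
  differencesFrom-≰ k M i j k≰j with k ≤? j
  ... | yes k≤j = ⊥-elim (k≰j k≤j)
  ... | no  _   = refl

  -- Differencing also column a+1 is a single column subtraction, since column a
  -- is still untouched.
  differencesFrom-step : ∀ n M a → suc a < n →
    detN n (differencesFrom (suc a) M) ≈ detN n (differencesFrom (suc (suc a)) M)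
  differencesFrom-step n M a a< =
    detN-subtractColumn n (differencesFrom (suc (suc a)) M) (differencesFrom (suc a) M) a a< outside target
    where
    outside : ∀ i j → j ≢ suc a → differencesFrom (suc a) M i j ≈ differencesFrom (suc (suc a)) M i j
    outside i j j≢sa with suc a ≤? j
    ... | no  sa≰j = sym (differencesFrom-≰ (suc (suc a)) M i j (λ le → sa≰j (<⇒≤ le)))
    ... | yes sa≤j with <-cmp (suc a) j
    ...   | tri< sa<j _ _ = sym (differencesFrom-≤ (suc (suc a)) M i j sa<j)
    ...   | tri≈ _ e _    = ⊥-elim (j≢sa (P.sym e))
    ...   | tri> _ _ j<sa = ⊥-elim (<⇒≱ j<sa sa≤j)
    target : ∀ i → differencesFrom (suc a) M i (suc a) ≈
                   differencesFrom (suc (suc a)) M i (suc a) - differencesFrom (suc (suc a)) M i a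
    target i = trans (differencesFrom-≤ (suc a) M i (suc a) ≤-refl)
      (+-cong (sym (differencesFrom-≰ (suc (suc a)) M i (suc a) (<⇒≱ ≤-refl)))
              (-‿cong (sym (differencesFrom-≰ (suc (suc a)) M i a (λ le → <⇒≱ ≤-refl (<⇒≤ le))))))

  differencesFrom-beyond : ∀ n M d → n ≤ suc d → detN n (differencesFrom (suc d) M) ≈ detN n M
  differencesFrom-beyond n M d n≤ =
    detN-cong n (λ i j _ j< → differencesFrom-≰ (suc d) M i j (<⇒≱ (≤-trans j< n≤)))

  differencesFrom-invariant : ∀ n M fuel d → n ≤ fuel ℕ.+ suc d → detN n (differencesFrom (suc d) M) ≈ detN n M
  differencesFrom-invariant n M zero       d n≤ = differencesFrom-beyond n M d n≤
  differencesFrom-invariant n M (suc fuel) d n≤ with n ≤? suc d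
  ... | yes n≤′ = differencesFrom-beyond n M d n≤′
  ... | no  n≰  = trans (differencesFrom-step n M d (≰⇒> n≰))
                        (differencesFrom-invariant n M fuel (suc d) (P.subst (n ≤_) (P.sym (+-suc fuel (suc d))) n≤))

  detN-differences : ∀ n M → detN n (differencesFrom 1 M) ≈ detN n M
  detN-differences n M = differencesFrom-invariant n M n 0 (m≤m+n n 1)

  detN-firstRowUnit : ∀ n M → (∀ j → M 0 (suc j) ≈ 0#) →
    detN (suc n) M ≈ M 0 0 * detN n (λ i k → M (suc i) (suc k))
  detN-firstRowUnit n M zeros = begin
    1# * (M 0 0 * detN n (minor M 0)) + sumN n (λ j → cofactorTerm n M (suc j))
      ≈⟨ +-cong (*-identityˡ _) (sumN-zero n (λ j _ → trans (*-cong refl (*-cong (zeros j) refl))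
                                                           (trans (*-cong refl (zeroˡ _)) (zeroʳ _)))) ⟩
    M 0 0 * detN n (minor M 0) + 0# ≈⟨ +-identityʳ _ ⟩
    M 0 0 * detN n (λ i k → M (suc i) (suc k)) ∎

  detN-onesRow : ∀ n M → (∀ j → M 0 j ≈ 1#) →
    detN (suc n) M ≈ detN n (λ i j → M (suc i) (suc j) - M (suc i) j)
  detN-onesRow n M ones = begin
    detN (suc n) M                    ≈⟨ sym (detN-differences (suc n) M) ⟩
    detN (suc n) (differencesFrom 1 M) ≈⟨ detN-firstRowUnit n (differencesFrom 1 M) firstRow ⟩
    differencesFrom 1 M 0 0 * detN n (λ i k → differencesFrom 1 M (suc i) (suc k))
      ≈⟨ *-cong (trans (differencesFrom-≰ 1 M 0 0 (λ ())) (ones 0))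
                (detN-cong n (λ i k _ _ → differencesFrom-≤ 1 M (suc i) (suc k) (s≤s z≤n))) ⟩
    1# * detN n (λ i j → M (suc i) (suc j) - M (suc i) j) ≈⟨ *-identityˡ _ ⟩
    detN n (λ i j → M (suc i) (suc j) - M (suc i) j) ∎
    where
    firstRow : ∀ j → differencesFrom 1 M 0 (suc j) ≈ 0#
    firstRow j = trans (differencesFrom-≤ 1 M 0 (suc j) (s≤s z≤n))
                       (trans (+-cong (ones (suc j)) (-‿cong (ones j))) (-‿inverseʳ 1#))

  detN-scaleColumns : ∀ n (f : ℕ → Carrier) N → detN n (λ i j → f j * N i j) ≈ prodN n f * detN n N
  detN-scaleColumns zero    f N = sym (*-identityˡ 1#)
  detN-scaleColumns (suc n) f N =
    trans (sumN-cong (suc n) term) (sumN-scale (suc n) (prodN (suc n) f) (cofactorTerm n N))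
    where
    term : ∀ j → j < suc n →
      sign j * ((f j * N 0 j) * detN n (λ i k → f (punchInℕ j k) * N (suc i) (punchInℕ j k)))
        ≈ prodN (suc n) f * cofactorTerm n N j
    term j j< = begin
      sign j * ((f j * N 0 j) * detN n (λ i k → f (punchInℕ j k) * N (suc i) (punchInℕ j k)))
        ≈⟨ *-cong refl (*-cong refl (detN-scaleColumns n (λ k → f (punchInℕ j k)) (minor N j))) ⟩
      sign j * ((f j * N 0 j) * (prodN n (λ k → f (punchInℕ j k)) * detN n (minor N j)))
        ≈⟨ *-cong refl (interchange _ _ _ _) ⟩
      sign j * ((f j * prodN n (λ k → f (punchInℕ j k))) * (N 0 j * detN n (minor N j)))
        ≈⟨ x∙yz≈y∙xz _ _ _ ⟩
      (f j * prodN n (λ k → f (punchInℕ j k))) * cofactorTerm n N j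
        ≈⟨ *-cong (prodN-punchIn n f j j<) refl ⟩
      prodN (suc n) f * cofactorTerm n N j ∎

module StirlingMatrices {c ℓ : Level} (R : CommutativeRing c ℓ) where
  open CommutativeRing R
  open VStirling R
  open RangeSums R
  open Determinants R
  open import Relation.Binary.Reasoning.Setoid setoid
  open AbelianGroupProperties +-abelianGroup using (xyx⁻¹≈y)

  elem-difference : ∀ i x L → elem (suc i) (x ∷ L) - elem (suc i) L ≈ x * elem i L
  elem-difference i x L = xyx⁻¹≈y _ _

  compl-cons : ∀ i x L → compl i (x ∷ L) ≡ sumF (suc i) (λ m → pow x (toℕ m) * compl (i ℕ.∸ toℕ m) L)
  compl-cons zero    x L = P.refl
  compl-cons (suc i) x L = P.refl

  compl-zero : ∀ L → compl 0 L ≈ 1#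
  compl-zero []      = refl
  compl-zero (x ∷ L) = trans (+-identityʳ _) (trans (*-identityˡ _) (compl-zero L))

  -- h_{i+1}(x ∷ L) = h_{i+1}(L) + x·h_i(x ∷ L): split off the x⁰ term.
  compl-step : ∀ i x L → compl (suc i) (x ∷ L) ≈ compl (suc i) L + x * compl i (x ∷ L)
  compl-step i x L = +-cong (*-identityˡ _)
    (trans (sumF-cong (suc i) (λ m → *-assoc x (pow x (toℕ m)) (compl (i ℕ.∸ toℕ m) L)))
      (trans (sumF-scale (suc i) x (λ m → pow x (toℕ m) * compl (i ℕ.∸ toℕ m) L))
        (*-cong refl (reflexive (P.sym (compl-cons i x L))))))

  compl-difference : ∀ i x L → compl (suc i) (x ∷ L) - compl (suc i) L ≈ x * compl i (x ∷ L)
  compl-difference i x L = trans (+-cong (compl-step i x L) refl) (xyx⁻¹≈y _ _)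

  listOf-cong : ∀ n {f f′ : ℕ → Carrier} → (∀ m → f m ≡ f′ m) → listOf n f ≡ listOf n f′
  listOf-cong zero    f≡f′ = P.refl
  listOf-cong (suc n) f≡f′ = P.cong₂ _∷_ (f≡f′ 0) (listOf-cong n (λ m → f≡f′ (suc m)))

  [1+m]-[1+n]≡m-n : ∀ m n → + suc m ℤ.- + suc n ≡ + m ℤ.- + n
  [1+m]-[1+n]≡m-n m n = P.trans ([1+m]⊖[1+n]≡m⊖n m n) (P.sym (m-n≡m⊖n m n))

  column : (ℤ → Carrier) → ℕ → ℕ → List Carrier
  column g N j = listOf N (λ m → g (+ m ℤ.- + j))

  column-suc : ∀ g N j → column g (suc N) (suc j) ≡ g (+ 0 ℤ.- + suc j) ∷ column g N j
  column-suc g N j = P.cong (_ ∷_) (listOf-cong N (λ m → P.cong g ([1+m]-[1+n]≡m-n m j)))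

  firstKind : (ℤ → Carrier) → ℕ → Matrix
  firstKind g s i j = elem i (column g (s ℕ.+ i ℕ.+ j) j)

  firstKindValue : (ℤ → Carrier) → ℕ → Carrier
  firstKindValue g r = prodN (suc r) (λ k → prodN k (λ t → g (+ t ℤ.- + k)))

  firstKind-difference : ∀ g s i j →
    firstKind g s (suc i) (suc j) - firstKind g s (suc i) j ≈ g (+ 0 ℤ.- + suc j) * firstKind g (suc s) i j
  firstKind-difference g s i j = begin
    firstKind g s (suc i) (suc j) - elem (suc i) L
      ≈⟨ reflexive (P.cong (λ l → elem (suc i) l - elem (suc i) L) split) ⟩
    elem (suc i) (x ∷ L) - elem (suc i) L
      ≈⟨ elem-difference i x L ⟩
    x * elem i L
      ≈⟨ reflexive (P.cong (λ n → x * elem i (column g n j)) (P.cong (ℕ._+ j) (+-suc s i))) ⟩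
    x * firstKind g (suc s) i j ∎
    where
    x = g (+ 0 ℤ.- + suc j)
    L = column g (s ℕ.+ suc i ℕ.+ j) j
    split : column g (s ℕ.+ suc i ℕ.+ suc j) (suc j) ≡ x ∷ L
    split = P.trans (P.cong (λ n → column g n (suc j)) (+-suc (s ℕ.+ suc i) j)) (column-suc g _ j)

  firstKindValue-step : ∀ g r →
    firstKindValue g (suc r) ≈ prodN (suc r) (λ k → g (+ 0 ℤ.- + suc k)) * firstKindValue g r
  firstKindValue-step g r = begin
    1# * prodN (suc r) (λ k → g (+ 0 ℤ.- + suc k) * prodN k (λ t → g (+ suc t ℤ.- + suc k)))
      ≈⟨ *-identityˡ _ ⟩
    prodN (suc r) (λ k → g (+ 0 ℤ.- + suc k) * prodN k (λ t → g (+ suc t ℤ.- + suc k)))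
      ≈⟨ prodN-mul (suc r) (λ k → g (+ 0 ℤ.- + suc k)) (λ k → prodN k (λ t → g (+ suc t ℤ.- + suc k))) ⟩
    prodN (suc r) (λ k → g (+ 0 ℤ.- + suc k)) * prodN (suc r) (λ k → prodN k (λ t → g (+ suc t ℤ.- + suc k)))
      ≈⟨ *-cong refl (prodN-cong (suc r) (λ k _ → prodN-cong k (λ t _ →
           reflexive (P.cong g ([1+m]-[1+n]≡m-n t k))))) ⟩
    prodN (suc r) (λ k → g (+ 0 ℤ.- + suc k)) * firstKindValue g r ∎

  firstKind-det : ∀ r g s → detN (suc r) (firstKind g s) ≈ firstKindValue g r
  firstKind-det zero    g s = trans (+-identityʳ _) (*-identityˡ _)
  firstKind-det (suc r) g s = begin
    detN (suc (suc r)) (firstKind g s)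
      ≈⟨ detN-onesRow (suc r) (firstKind g s) (λ j → refl) ⟩
    detN (suc r) (λ i j → firstKind g s (suc i) (suc j) - firstKind g s (suc i) j)
      ≈⟨ detN-cong (suc r) (λ i j _ _ → firstKind-difference g s i j) ⟩
    detN (suc r) (λ i j → y j * firstKind g (suc s) i j)
      ≈⟨ detN-scaleColumns (suc r) y (firstKind g (suc s)) ⟩
    prodN (suc r) y * detN (suc r) (firstKind g (suc s))
      ≈⟨ *-cong refl (firstKind-det r g (suc s)) ⟩
    prodN (suc r) y * firstKindValue g r
      ≈⟨ sym (firstKindValue-step g r) ⟩
    firstKindValue g (suc r) ∎
    where
    y : ℕ → Carrier
    y j = g (+ 0 ℤ.- + suc j)

  secondKind : (ℤ → Carrier) → ℕ → Matrix
  secondKind g s i j = compl i (column g (suc (s ℕ.+ j)) j)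

  secondKindValue : (ℤ → Carrier) → ℕ → Carrier
  secondKindValue g r = prodN (suc r) (λ k → pow (g (+ 0 ℤ.- + k)) k)

  shift : (ℤ → Carrier) → ℤ → Carrier
  shift g d = g (d ℤ.- + 1)

  shift-column : ∀ g N j → column (shift g) N j ≡ column g N (suc j)
  shift-column g N j = listOf-cong N (λ m → P.cong g (minus-one (+ m) (+ j)))
    where
    minus-one : ∀ (x y : ℤ) → (x ℤ.- y) ℤ.- + 1 ≡ x ℤ.- (+ 1 ℤ.+ y)
    minus-one = solve-∀

  secondKind-difference : ∀ g s i j →
    secondKind g s (suc i) (suc j) - secondKind g s (suc i) j ≈ g (+ 0 ℤ.- + suc j) * secondKind (shift g) (suc s) i j
  secondKind-difference g s i j = begin
    secondKind g s (suc i) (suc j) - compl (suc i) L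
      ≈⟨ reflexive (P.cong (λ l → compl (suc i) l - compl (suc i) L) split) ⟩
    compl (suc i) (x ∷ L) - compl (suc i) L
      ≈⟨ compl-difference i x L ⟩
    x * compl i (x ∷ L)
      ≈⟨ reflexive (P.cong (λ l → x * compl i l) (P.sym (P.trans shifted split))) ⟩
    x * secondKind (shift g) (suc s) i j ∎
    where
    x = g (+ 0 ℤ.- + suc j)
    L = column g (suc (s ℕ.+ j)) j
    split : column g (suc (s ℕ.+ suc j)) (suc j) ≡ x ∷ L
    split = P.trans (P.cong (λ n → column g (suc n) (suc j)) (+-suc s j)) (column-suc g _ j)
    shifted : column (shift g) (suc (suc s ℕ.+ j)) j ≡ column g (suc (s ℕ.+ suc j)) (suc j)
    shifted = P.trans (shift-column g _ j) (P.cong (λ n → column g (suc n) (suc j)) (P.sym (+-suc s j)))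

  secondKindValue-step : ∀ g r →
    secondKindValue g (suc r) ≈ prodN (suc r) (λ k → g (+ 0 ℤ.- + suc k)) * secondKindValue (shift g) r
  secondKindValue-step g r = begin
    1# * prodN (suc r) (λ k → y k * pow (y k) k) ≈⟨ *-identityˡ _ ⟩
    prodN (suc r) (λ k → y k * pow (y k) k)      ≈⟨ prodN-mul (suc r) y (λ k → pow (y k) k) ⟩
    prodN (suc r) y * prodN (suc r) (λ k → pow (y k) k)
      ≈⟨ *-cong refl (prodN-cong (suc r) (λ k _ → reflexive (P.cong (λ l → pow (g l) k) (minus-one (+ k))))) ⟩
    prodN (suc r) y * secondKindValue (shift g) r ∎
    where
    y : ℕ → Carrier
    y k = g (+ 0 ℤ.- + suc k)
    minus-one : ∀ (x : ℤ) → + 0 ℤ.- (+ 1 ℤ.+ x) ≡ (+ 0 ℤ.- x) ℤ.- + 1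
    minus-one = solve-∀

  secondKind-det : ∀ r g s → detN (suc r) (secondKind g s) ≈ secondKindValue g r
  secondKind-det zero    g s =
    trans (+-identityʳ _) (trans (*-identityˡ _) (trans (*-identityʳ _)
      (trans (compl-zero (column g (suc (s ℕ.+ 0)) 0)) (sym (*-identityˡ 1#)))))
  secondKind-det (suc r) g s = begin
    detN (suc (suc r)) (secondKind g s)
      ≈⟨ detN-onesRow (suc r) (secondKind g s) (λ j → compl-zero (column g (suc (s ℕ.+ j)) j)) ⟩
    detN (suc r) (λ i j → secondKind g s (suc i) (suc j) - secondKind g s (suc i) j)
      ≈⟨ detN-cong (suc r) (λ i j _ _ → secondKind-difference g s i j) ⟩
    detN (suc r) (λ i j → y j * secondKind (shift g) (suc s) i j)
      ≈⟨ detN-scaleColumns (suc r) y (secondKind (shift g) (suc s)) ⟩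
    prodN (suc r) y * detN (suc r) (secondKind (shift g) (suc s))
      ≈⟨ *-cong refl (secondKind-det r (shift g) (suc s)) ⟩
    prodN (suc r) y * secondKindValue (shift g) r
      ≈⟨ sym (secondKindValue-step g r) ⟩
    secondKindValue g (suc r) ∎
    where
    y : ℕ → Carrier
    y j = g (+ 0 ℤ.- + suc j)

module Specialization {c ℓ : Level} (K : CommutativeRing c ℓ)
    (v w : ℤ → CommutativeRing.Carrier K) (α β : ℤ) (s : ℕ) where
  open CommutativeRing K
  open VStirling K
  open RangeSums K
  open Determinants K using (Matrix)
  open StirlingMatrices K

  firstKindSequence : ℤ → Carrier
  firstKindSequence d = v (α ℤ.+ + s ℤ.- + 1 ℤ.- d) * w (β ℤ.+ d)

  secondKindSequence : ℤ → Carrier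
  secondKindSequence d = v (α ℤ.+ + s ℤ.- d) * w (β ℤ.+ d)

  +-three : ∀ a b d → + (a ℕ.+ b ℕ.+ d) ≡ + a ℤ.+ + b ℤ.+ + d
  +-three a b d = P.trans (pos-+ (a ℕ.+ b) d) (P.cong (ℤ._+ + d) (pos-+ a b))

  row-index : ∀ a b → + (s ℕ.+ a ℕ.+ b) ℤ.- + (s ℕ.+ b) ≡ + a
  row-index a b = P.trans (P.cong₂ ℤ._-_ (+-three s a b) (pos-+ s b)) (cancel (+ s) (+ a) (+ b))
    where
    cancel : ∀ (S A B : ℤ) → (S ℤ.+ A ℤ.+ B) ℤ.- (S ℤ.+ B) ≡ A
    cancel = solve-∀

  w-index : ∀ b m → β ℤ.- + b ℤ.+ + m ≡ β ℤ.+ (+ m ℤ.- + b)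
  w-index b m = regroup β (+ b) (+ m)
    where
    regroup : ∀ (B′ B M : ℤ) → B′ ℤ.- B ℤ.+ M ≡ B′ ℤ.+ (M ℤ.- B)
    regroup = solve-∀

  cVMatrix : Matrix
  cVMatrix a b = cV v w (α ℤ.- + a) (β ℤ.- + b) (s ℕ.+ a ℕ.+ b) (s ℕ.+ b)

  SVMatrix : Matrix
  SVMatrix a b = SV v w α (β ℤ.- + b) (s ℕ.+ a ℕ.+ b) (s ℕ.+ b)

  cV-normalized : ∀ a b → cVMatrix a b ≈ firstKind firstKindSequence s a b
  cV-normalized a b = reflexive (P.cong₂ elemℤ (row-index a b) (listOf-cong (s ℕ.+ a ℕ.+ b) (λ m →
    P.cong₂ _*_ (P.cong v (P.trans (P.cong (λ z → α ℤ.- + a ℤ.+ z ℤ.- + 1 ℤ.- + m) (+-three s a b))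
                                   (v-index α (+ s) (+ a) (+ b) (+ m))))
                (P.cong w (w-index b m)))))
    where
    v-index : ∀ (A′ S A B M : ℤ) →
      A′ ℤ.- A ℤ.+ (S ℤ.+ A ℤ.+ B) ℤ.- + 1 ℤ.- M ≡ A′ ℤ.+ S ℤ.- + 1 ℤ.- (M ℤ.- B)
    v-index = solve-∀

  SV-normalized : ∀ a b → SVMatrix a b ≈ secondKind secondKindSequence s a b
  SV-normalized a b = reflexive (P.cong₂ complℤ (row-index a b) (listOf-cong (suc (s ℕ.+ b)) (λ m →
    P.cong₂ _*_ (P.cong v (P.trans (P.cong (λ z → α ℤ.+ z ℤ.- + m) (pos-+ s b)) (v-index α (+ s) (+ b) (+ m))))
                (P.cong w (w-index b m)))))
    where
    v-index : ∀ (A′ S B M : ℤ) → A′ ℤ.+ (S ℤ.+ B) ℤ.- M ≡ A′ ℤ.+ S ℤ.- (M ℤ.- B)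
    v-index = solve-∀

  firstKind-product : ∀ r →
    prodF (suc r) (λ k → prodF (toℕ k) (λ t →
      v (α ℤ.+ + s ℤ.+ + toℕ k ℤ.- + suc (toℕ t)) * w (β ℤ.- + toℕ k ℤ.+ + suc (toℕ t) ℤ.- + 1)))
      ≈ firstKindValue firstKindSequence r
  firstKind-product r =
    trans (prodF≈prodN (suc r) (λ k → prodF k (λ t → factor k (toℕ t)))) (prodN-cong (suc r) (λ k _ →
    trans (prodF≈prodN k (factor k)) (prodN-cong k (λ t _ → reflexive (P.cong₂ _*_
      (P.cong v (v-index α (+ s) (+ k) (+ t))) (P.cong w (w-index′ β (+ k) (+ t))))))))
    where
    factor : ℕ → ℕ → Carrier
    factor k t = v (α ℤ.+ + s ℤ.+ + k ℤ.- + suc t) * w (β ℤ.- + k ℤ.+ + suc t ℤ.- + 1)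
    v-index : ∀ (A′ S k t : ℤ) →
      A′ ℤ.+ S ℤ.+ k ℤ.- (+ 1 ℤ.+ t) ≡ A′ ℤ.+ S ℤ.- + 1 ℤ.- (t ℤ.- k)
    v-index = solve-∀
    w-index′ : ∀ (B′ k t : ℤ) → B′ ℤ.- k ℤ.+ (+ 1 ℤ.+ t) ℤ.- + 1 ≡ B′ ℤ.+ (t ℤ.- k)
    w-index′ = solve-∀

  secondKind-product : ∀ r →
    prodF (suc r) (λ k → pow (v (α ℤ.+ + s ℤ.+ + toℕ k) * w (β ℤ.- + toℕ k)) (toℕ k))
      ≈ secondKindValue secondKindSequence r
  secondKind-product r =
    trans (prodF≈prodN (suc r) (λ k → pow (v (α ℤ.+ + s ℤ.+ + k) * w (β ℤ.- + k)) k)) (prodN-cong (suc r) (λ k _ →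
      reflexive (P.cong (λ z → pow z k)
        (P.cong₂ _*_ (P.cong v (v-index α (+ s) (+ k))) (P.cong w (w-index′ β (+ k)))))))
    where
    v-index : ∀ (A′ S k : ℤ) → A′ ℤ.+ S ℤ.+ k ≡ A′ ℤ.+ S ℤ.- (+ 0 ℤ.- k)
    v-index = solve-∀
    w-index′ : ∀ (B′ k : ℤ) → B′ ℤ.- k ≡ B′ ℤ.+ (+ 0 ℤ.- k)
    w-index′ = solve-∀

corollary6p3 : ∀ {c ℓ : Level} (K : CommutativeRing c ℓ) →
    (v w : ℤ → CommutativeRing.Carrier K) (α β : ℤ) (s r : ℕ) →
      Eq K
        (VStirling.det K (suc r) (λ i j →
          VStirling.cV K v w (α ℤ.- + toℕ i) (β ℤ.- + toℕ j) (s ℕ.+ toℕ i ℕ.+ toℕ j) (s ℕ.+ toℕ j)))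
        (VStirling.prodF K (suc r) (λ k → VStirling.prodF K (toℕ k) (λ t →
          Mul K (v (α ℤ.+ + s ℤ.+ + toℕ k ℤ.- + suc (toℕ t)))
                (w (β ℤ.- + toℕ k ℤ.+ + suc (toℕ t) ℤ.- + 1)))))
      × Eq K
        (VStirling.det K (suc r) (λ i j →
          VStirling.SV K v w α (β ℤ.- + toℕ j) (s ℕ.+ toℕ i ℕ.+ toℕ j) (s ℕ.+ toℕ j)))
        (VStirling.prodF K (suc r) (λ k →
          VStirling.pow K (Mul K (v (α ℤ.+ + s ℤ.+ + toℕ k)) (w (β ℤ.- + toℕ k))) (toℕ k)))
corollary6p3 K v w α β s r = firstKindCase , secondKindCase
  where
  open CommutativeRing K using (trans; sym)
  open Determinants K using (det≈detN; detN-cong)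
  open StirlingMatrices K using (firstKind-det; secondKind-det)
  open Specialization K v w α β s
  firstKindCase = trans (det≈detN (suc r) cVMatrix)
                 (trans (detN-cong (suc r) (λ a b _ _ → cV-normalized a b))
                 (trans (firstKind-det r firstKindSequence s)
                        (sym (firstKind-product r))))
  secondKindCase = trans (det≈detN (suc r) SVMatrix)
                  (trans (detN-cong (suc r) (λ a b _ _ → SV-normalized a b))
                  (trans (secondKind-det r secondKindSequence s)
                         (sym (secondKind-product r))))
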